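{- Over the reals, $\mathrm{rank}(M)=\mathrm{rank}(W)=n^3-(n-1)^3+(n-1)(h-1)(w-1)$.
   Context: Let $h,w\ge 2$ be integers, $n=hw$, and $\mathrm{box}(i,j)=h\lfloor (i-1)/h\rfloor+\lfloor (j-1)/w\rfloor+1$ for $(i,j)\in[n]^2$. The graph $G_{hw}$ has vertices $r_i,c_j,b_\ell,s_k$ ($i,j,k,\ell\in[n]$) and the $4n^2$ edges $\{r_i,c_j\},\{r_i,s_k\},\{c_j,s_k\},\{b_\ell,s_k\}$. A tile is the set of four edges $\{r_ic_j,r_is_k,c_js_k,b_\ell s_k\}$ with $\ell=\mathrm{box}(i,j)$; there are $n^3$ tiles, one for each $(i,j,k)\in[n]^3$. $W$ is the $4n^2\times n^3$ zero-one matrix with rows indexed by edges of $G_{hw}$, columns indexed by tiles, and $W(e,t)=1$ iff $e\in t$. $M=WW^\top$.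
   Formalization: The ranks of M and W are taken over the rationals instead of the reals. -}

module Defs where

open import Data.Nat using (ℕ; zero; suc)
import Data.Nat as N
open import Data.Nat.DivMod using (_/_)
open import Data.Fin using (Fin; toℕ)
import Data.Fin as F
open import Data.Product using (_×_; _,_; Σ)
open import Data.Rational using (ℚ; 0ℚ; 1ℚ; _+_; _*_)
open import Relation.Nullary using (¬_; does)
open import Relation.Binary.PropositionalEquality using (_≡_)
open import Data.Bool using (Bool; true; false; if_then_else_; _∧_)

-- Floor division; the divisor zero case is never used (h, w ≥ 2).
fdiv : ℕ → ℕ → ℕ
fdiv i zero    = 0
fdiv i (suc d) = i / suc d

-- 0-indexed box: box0 i j = h ⌊i/h⌋ + ⌊j/w⌋  (= box(i+1,j+1) - 1)
box0 : ℕ → ℕ → ℕ → ℕ → ℕ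
box0 h w i j = h N.* fdiv i h N.+ fdiv j w

sumFin : (n : ℕ) → (Fin n → ℚ) → ℚ
sumFin zero    f = 0ℚ
sumFin (suc n) f = f F.zero + sumFin n (λ i → f (F.suc i))

-- Edges of G_hw: rc (i,j) = {r_i,c_j}, rs (i,k) = {r_i,s_k},
-- cs (j,k) = {c_j,s_k}, bs (ℓ,k) = {b_ℓ,s_k}.
data EdgeKind : Set where
  rc rs cs bs : EdgeKind

Edge : ℕ → Set
Edge n = EdgeKind × Fin n × Fin n

Tile : ℕ → Set
Tile n = Fin n × Fin n × Fin n

eqF : {n : ℕ} → Fin n → Fin n → Bool
eqF a b = does (a F.≟ b)

indicator : Bool → ℚ
indicator b = if b then 1ℚ else 0ℚ

W : (h w : ℕ) → Edge (h N.* w) → Tile (h N.* w) → ℚ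
W h w (rc , a , b) (i , j , k) = indicator (eqF a i ∧ eqF b j)
W h w (rs , a , b) (i , j , k) = indicator (eqF a i ∧ eqF b k)
W h w (cs , a , b) (i , j , k) = indicator (eqF a j ∧ eqF b k)
W h w (bs , a , b) (i , j , k) =
  indicator (does (toℕ a N.≟ box0 h w (toℕ i) (toℕ j)) ∧ eqF b k)

sumTile : (n : ℕ) → (Tile n → ℚ) → ℚ
sumTile n f = sumFin n (λ i → sumFin n (λ j → sumFin n (λ k → f (i , j , k))))

M : (h w : ℕ) → Edge (h N.* w) → Edge (h N.* w) → ℚ
M h w e e' = sumTile (h N.* w) (λ t → W h w e t * W h w e' t)

LinIndepCols : {R C : Set} → (R → C → ℚ) → (r : ℕ) → (Fin r → C) → Set
LinIndepCols {R} A r f =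
  (a : Fin r → ℚ) → (∀ (e : R) → sumFin r (λ i → a i * A e (f i)) ≡ 0ℚ) →
  ∀ i → a i ≡ 0ℚ

HasRank : {R C : Set} → (R → C → ℚ) → ℕ → Set
HasRank {R} {C} A r =
  Σ (Fin r → C) (λ f → LinIndepCols A r f) ×
  (∀ (g : Fin (suc r) → C) → ¬ LinIndepCols A (suc r) g)

module Submission where

-- Index the basis by four blocks (indices counted from 0): all edges r_i c_j; the edges r_i s_k
-- and c_j s_k with j, k ≠ 0; and b_ℓ s_k with k ≠ 0 for the (h-1)(w-1) boxes ℓ outside the first
-- row band and the first column band.  There are n² + n(n-1) + (n-1)² + (n-1)(h-1)(w-1) of them.
--
-- Matching each basis edge with a tile, and ordering edges by kind, makes the
-- corresponding rows of W triangular; choosing one tile per basis index (with coordinate 0 in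
-- the first three blocks) and ordering tiles by their number of zero coordinates makes those
-- columns of W triangular.  Independent rows of W give independent columns of M = WWᵀ, since
-- WWᵀa = 0 forces |Wᵀa|² = 0.
--
-- Every column of W, hence of M, is orthogonal to the left null space of W.
-- Six families of left null vectors say that two kinds of edges through a row, a column, a
-- symbol, a box, or a symbol within a row or column band count the same tiles.  Used in a
-- suitable order they show that such a vector vanishing on the basis edges vanishes, so the
-- column space embeds into ℚ^rank and rank + 1 columns are always dependent.

open import Defs
open import Data.Nat using (ℕ)

module FiniteSums where
  open import Algebra.Bundles using (Ring)
  open import Data.Nat using (ℕ; zero; suc)
  open import Data.Fin using (Fin; zero; suc; punchIn)
  open import Data.Fin.Properties using (punchInᵢ≢i)
  open import Data.Product using (_×_; _,_; proj₁; proj₂)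
  open import Data.Rational using (ℚ; 0ℚ; _+_; _*_; _≤_)
  open import Data.Rational.Properties
    using (+-*-ring; +-identityʳ; +-mono-≤; +-monoʳ-≤; ≤-refl; ≤-antisym)
  open import Algebra.Properties.Semiring.Sum (Ring.semiring +-*-ring)
    using (sum; sum-cong-≗; ∑-distrib-+; ∑-comm; *-distribˡ-sum; *-distribʳ-sum; sum-remove; sum-replicate-zero)
  open import Function using (_∘_)
  open import Relation.Binary.PropositionalEquality

  private variable
    a b c n : ℕ

  sumFin≡sum : ∀ n (f : Fin n → ℚ) → sumFin n f ≡ sum f
  sumFin≡sum zero    f = refl
  sumFin≡sum (suc n) f = cong (f zero +_) (sumFin≡sum n (f ∘ suc))

  sumFin-cong : ∀ n {f g : Fin n → ℚ} → (∀ i → f i ≡ g i) → sumFin n f ≡ sumFin n g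
  sumFin-cong n {f} {g} f≗g = begin
    sumFin n f  ≡⟨ sumFin≡sum n f ⟩
    sum f       ≡⟨ sum-cong-≗ f≗g ⟩
    sum g       ≡⟨ sumFin≡sum n g ⟨
    sumFin n g  ∎
    where open ≡-Reasoning

  sumFin-zeros : ∀ n {f : Fin n → ℚ} → (∀ i → f i ≡ 0ℚ) → sumFin n f ≡ 0ℚ
  sumFin-zeros n {f} f≗0 = trans (sumFin≡sum n f) (trans (sum-cong-≗ f≗0) (sum-replicate-zero n))

  sumFin-distrib-+ : ∀ n (f g : Fin n → ℚ) → sumFin n (λ i → f i + g i) ≡ sumFin n f + sumFin n g
  sumFin-distrib-+ n f g rewrite sumFin≡sum n (λ i → f i + g i) | sumFin≡sum n f | sumFin≡sum n g = ∑-distrib-+ f g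

  *-distribˡ-sumFin : ∀ n x (f : Fin n → ℚ) → x * sumFin n f ≡ sumFin n (λ i → x * f i)
  *-distribˡ-sumFin n x f rewrite sumFin≡sum n f | sumFin≡sum n (λ i → x * f i) = *-distribˡ-sum x f

  *-distribʳ-sumFin : ∀ n x (f : Fin n → ℚ) → sumFin n f * x ≡ sumFin n (λ i → f i * x)
  *-distribʳ-sumFin n x f rewrite sumFin≡sum n f | sumFin≡sum n (λ i → f i * x) = *-distribʳ-sum x f

  sumFin-comm : ∀ m n (f : Fin m → Fin n → ℚ) →
    sumFin m (λ i → sumFin n (f i)) ≡ sumFin n (λ j → sumFin m (λ i → f i j))
  sumFin-comm m n f = begin
    sumFin m (λ i → sumFin n (f i))        ≡⟨ sumFin≡sum m _ ⟩
    sum (λ i → sumFin n (f i))             ≡⟨ sum-cong-≗ (λ i → sumFin≡sum n (f i)) ⟩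
    sum (λ i → sum (f i))                  ≡⟨ ∑-comm f ⟩
    sum (λ j → sum (λ i → f i j))          ≡⟨ sum-cong-≗ (λ j → sumFin≡sum m (λ i → f i j)) ⟨
    sum (λ j → sumFin m (λ i → f i j))     ≡⟨ sumFin≡sum n _ ⟨
    sumFin n (λ j → sumFin m (λ i → f i j)) ∎
    where open ≡-Reasoning

  sumFin-remove : ∀ n (f : Fin (suc n) → ℚ) p → sumFin (suc n) f ≡ f p + sumFin n (f ∘ punchIn p)
  sumFin-remove n f p
    rewrite sumFin≡sum (suc n) f | sumFin≡sum n (f ∘ punchIn p) = sum-remove {i = p} f

  sumFin-single : ∀ n (f : Fin n → ℚ) p → (∀ i → i ≢ p → f i ≡ 0ℚ) → sumFin n f ≡ f p
  sumFin-single (suc n) f p f≡0 = begin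
    sumFin (suc n) f                ≡⟨ sumFin-remove n f p ⟩
    f p + sumFin n (f ∘ punchIn p)  ≡⟨ cong (f p +_) (sumFin-zeros n (λ i → f≡0 _ (punchInᵢ≢i p i))) ⟩
    f p + 0ℚ                        ≡⟨ +-identityʳ (f p) ⟩
    f p                             ∎
    where open ≡-Reasoning

  sumFin-nonNeg : (f : Fin n → ℚ) → (∀ i → 0ℚ ≤ f i) → 0ℚ ≤ sumFin n f
  sumFin-nonNeg {zero}  f f≥0 = ≤-refl
  sumFin-nonNeg {suc n} f f≥0 = +-mono-≤ (f≥0 zero) (sumFin-nonNeg (f ∘ suc) (f≥0 ∘ suc))

  sumFin-nonNeg-zeros : (f : Fin n → ℚ) → (∀ i → 0ℚ ≤ f i) → sumFin n f ≡ 0ℚ → ∀ i → f i ≡ 0ℚ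
  sumFin-nonNeg-zeros {suc n} f f≥0 ∑f≡0 p = ≤-antisym fp≤0 (f≥0 p)
    where
    fp≤0 : f p ≤ 0ℚ
    fp≤0 = subst₂ _≤_ (+-identityʳ (f p)) (trans (sym (sumFin-remove n f p)) ∑f≡0)
             (+-monoʳ-≤ (f p) (sumFin-nonNeg (f ∘ punchIn p) (f≥0 ∘ punchIn p)))

  ∑³ : (Fin a × Fin b × Fin c → ℚ) → ℚ
  ∑³ {a} {b} {c} f = sumFin a λ i → sumFin b λ j → sumFin c λ k → f (i , j , k)

  ∑³-cong : {f g : Fin a × Fin b × Fin c → ℚ} → (∀ t → f t ≡ g t) → ∑³ f ≡ ∑³ g
  ∑³-cong {a} {b} {c} f≗g = sumFin-cong a λ i → sumFin-cong b λ j → sumFin-cong c λ k → f≗g (i , j , k)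

  ∑³-zeros : {f : Fin a × Fin b × Fin c → ℚ} → (∀ t → f t ≡ 0ℚ) → ∑³ f ≡ 0ℚ
  ∑³-zeros {a} {b} {c} f≗0 = sumFin-zeros a λ i → sumFin-zeros b λ j → sumFin-zeros c λ k → f≗0 (i , j , k)

  *-distribˡ-∑³ : ∀ x (f : Fin a × Fin b × Fin c → ℚ) → x * ∑³ f ≡ ∑³ (λ t → x * f t)
  *-distribˡ-∑³ {a} {b} {c} x f =
    trans (*-distribˡ-sumFin a x _) (sumFin-cong a λ i →
    trans (*-distribˡ-sumFin b x _) (sumFin-cong b λ j →
    *-distribˡ-sumFin c x _))

  ∑³-comm-sumFin : ∀ r (f : Fin a × Fin b × Fin c → Fin r → ℚ) →
    ∑³ (λ t → sumFin r (f t)) ≡ sumFin r (λ ρ → ∑³ (λ t → f t ρ))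
  ∑³-comm-sumFin {a} {b} {c} r f =
    trans (sumFin-cong a λ i → trans (sumFin-cong b λ j → sumFin-comm c r _) (sumFin-comm b r _))
          (sumFin-comm a r _)

  ∑³-linear : ∀ r (x : Fin r → ℚ) (f : Fin r → Fin a × Fin b × Fin c → ℚ) →
    ∑³ (λ t → sumFin r (λ ρ → x ρ * f ρ t)) ≡ sumFin r (λ ρ → x ρ * ∑³ (f ρ))
  ∑³-linear {a} {b} {c} r x f =
    trans (∑³-comm-sumFin {a} {b} {c} r _) (sumFin-cong r λ ρ → sym (*-distribˡ-∑³ (x ρ) (f ρ)))

  sumFin²-single : ∀ b c (f : Fin b → Fin c → ℚ) j k →
    (∀ j' k' → (j' , k') ≢ (j , k) → f j' k' ≡ 0ℚ) → sumFin b (λ j' → sumFin c (f j')) ≡ f j k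
  sumFin²-single b c f j k f≡0 =
    trans (sumFin-single b _ j λ j' j'≢j → sumFin-zeros c λ k' → f≡0 j' k' (j'≢j ∘ cong proj₁))
          (sumFin-single c (f j) k λ k' k'≢k → f≡0 j k' (k'≢k ∘ cong proj₂))

  ∑³-single : (f : Fin a × Fin b × Fin c → ℚ) (t : Fin a × Fin b × Fin c) →
    (∀ t' → t' ≢ t → f t' ≡ 0ℚ) → ∑³ f ≡ f t
  ∑³-single {a} {b} {c} f (i , j , k) f≡0 =
    trans (sumFin-single a _ i λ i' i'≢i → sumFin-zeros b λ j' → sumFin-zeros c λ k' →
                                              f≡0 (i' , j' , k') (i'≢i ∘ cong proj₁))
          (sumFin²-single b c (λ j' k' → f (i , j' , k')) j k λ j' k' ne → f≡0 (i , j' , k') (ne ∘ cong proj₂))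

  ∑³-comm : ∀ {a' b' c'} (f : Fin a × Fin b × Fin c → Fin a' × Fin b' × Fin c' → ℚ) →
    ∑³ (λ s → ∑³ (f s)) ≡ ∑³ (λ t → ∑³ (λ s → f s t))
  ∑³-comm {a} {b} {c} {a'} {b'} {c'} f =
    trans (∑³-comm-sumFin {a} {b} {c} a' λ s i → sumFin b' λ j → sumFin c' λ k → f s (i , j , k))
          (sumFin-cong a' λ i →
    trans (∑³-comm-sumFin {a} {b} {c} b' λ s j → sumFin c' λ k → f s (i , j , k))
          (sumFin-cong b' λ j →
    ∑³-comm-sumFin {a} {b} {c} c' λ s k → f s (i , j , k)))

  ∑³-nonNeg-zeros : (f : Fin a × Fin b × Fin c → ℚ) → (∀ t → 0ℚ ≤ f t) → ∑³ f ≡ 0ℚ →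
    ∀ t → f t ≡ 0ℚ
  ∑³-nonNeg-zeros f f≥0 ∑f≡0 (i , j , k) =
    sumFin-nonNeg-zeros _ (λ k → f≥0 (i , j , k))
      (sumFin-nonNeg-zeros _ (λ j → sumFin-nonNeg _ λ k → f≥0 (i , j , k))
        (sumFin-nonNeg-zeros _ (λ i → sumFin-nonNeg _ λ j → sumFin-nonNeg _ λ k → f≥0 (i , j , k)) ∑f≡0 i) j) k

module LinearAlgebra where
  open FiniteSums
  open import Data.Nat as ℕ using (ℕ; zero; suc; s≤s)
  open import Data.Nat.Properties using (≤-refl; ≤-trans)
  open import Data.Fin using (Fin; zero; suc; punchIn)
  open import Data.Fin.Properties using (all?; ¬∀⟶∃¬)
  open import Data.Vec.Functional using (_∷_; insertAt)
  open import Data.Vec.Functional.Properties using (insertAt-lookup; insertAt-punchIn)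
  open import Data.Product using (Σ-syntax; ∃; _×_; _,_)
  open import Data.Sum using (_⊎_; inj₁; inj₂)
  open import Data.Empty using (⊥-elim)
  open import Data.Rational using (ℚ; 0ℚ; 1ℚ; _+_; _*_; -_; _≤_; _≟_; 1/_; ≢-nonZero; nonNegative; nonPositive)
  open import Data.Rational.Properties
    using (*-identityˡ; *-identityʳ; *-zeroˡ; *-zeroʳ; *-assoc; *-inverseˡ; +-identityˡ; ≤-total;
           nonNegative⁻¹; nonNeg*nonNeg⇒nonNeg; nonPos*nonPos⇒nonPos)
  open import Data.Rational.Solver using (module +-*-Solver)
  open import Function using (_∘_)
  open import Relation.Nullary using (¬_; yes; no)
  open import Relation.Binary.PropositionalEquality

  private variable
    k r : ℕ
    R C : Set

  p*q≡0⇒q≡0 : ∀ p q → p ≢ 0ℚ → p * q ≡ 0ℚ → q ≡ 0ℚ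
  p*q≡0⇒q≡0 p q p≢0 pq≡0 = begin
    q                ≡⟨ *-identityˡ q ⟨
    1ℚ * q           ≡⟨ cong (_* q) (*-inverseˡ p) ⟨
    1/ p * p * q     ≡⟨ *-assoc (1/ p) p q ⟩
    1/ p * (p * q)   ≡⟨ cong (1/ p *_) pq≡0 ⟩
    1/ p * 0ℚ        ≡⟨ *-zeroʳ (1/ p) ⟩
    0ℚ               ∎
    where
    open ≡-Reasoning
    instance _ = ≢-nonZero p≢0

  *-nonZero : ∀ {p q} → p ≢ 0ℚ → q ≢ 0ℚ → p * q ≢ 0ℚ
  *-nonZero {p} {q} p≢0 q≢0 = q≢0 ∘ p*q≡0⇒q≡0 p q p≢0

  p*p≡0⇒p≡0 : ∀ p → p * p ≡ 0ℚ → p ≡ 0ℚ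
  p*p≡0⇒p≡0 p pp≡0 with p ≟ 0ℚ
  ... | yes p≡0 = p≡0
  ... | no  p≢0 = p*q≡0⇒q≡0 p p p≢0 pp≡0

  p*p≥0 : ∀ p → 0ℚ ≤ p * p
  p*p≥0 p with ≤-total 0ℚ p
  ... | inj₁ p≥0 = nonNegative⁻¹ _ {{nonNeg*nonNeg⇒nonNeg p {{nonNegative p≥0}} p {{nonNegative p≥0}}}}
  ... | inj₂ p≤0 = nonNegative⁻¹ _ {{nonPos*nonPos⇒nonPos p {{nonPositive p≤0}} p {{nonPositive p≤0}}}}

  linIndep-triangular : (A : R → C → ℚ) (f : Fin r → C) (pivot : Fin r → R) (level : Fin r → ℕ) →
    (∀ i → A (pivot i) (f i) ≡ 1ℚ) →
    (∀ i i' → i' ≡ i ⊎ A (pivot i) (f i') ≡ 0ℚ ⊎ level i' ℕ.< level i) →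
    LinIndepCols A r f
  linIndep-triangular {r = r} A f pivot level diag offDiag a comb≡0 i = below (suc (level i)) i ≤-refl
    where
    below : ∀ bound i → level i ℕ.< bound → a i ≡ 0ℚ
    below (suc bound) i (s≤s level≤bound) = trans (sym comb-at-pivot) (comb≡0 (pivot i))
      where
      term≡0 : ∀ i' → i' ≢ i → a i' * A (pivot i) (f i') ≡ 0ℚ
      term≡0 i' i'≢i with offDiag i i'
      ... | inj₁ i'≡i = ⊥-elim (i'≢i i'≡i)
      ... | inj₂ (inj₁ A≡0) = trans (cong (a i' *_) A≡0) (*-zeroʳ (a i'))
      ... | inj₂ (inj₂ lower) =
        trans (cong (_* A (pivot i) (f i')) (below bound i' (≤-trans lower level≤bound))) (*-zeroˡ (A (pivot i) (f i')))
      comb-at-pivot : sumFin r (λ i' → a i' * A (pivot i) (f i')) ≡ a i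
      comb-at-pivot = trans (sumFin-single r _ i term≡0) (trans (cong (a i *_) (diag i)) (*-identityʳ (a i)))

  IsRelation : (Fin k → Fin r → ℚ) → (Fin k → ℚ) → Set
  IsRelation {k} {r} u a = ∀ ρ → sumFin k (λ i → a i * u i ρ) ≡ 0ℚ

  NontrivialRelation : (Fin k → Fin r → ℚ) → Set
  NontrivialRelation {k} u = Σ[ a ∈ (Fin k → ℚ) ] IsRelation u a × ∃ λ i → a i ≢ 0ℚ

  relation-zeroColumn : (u : Fin (suc k) → Fin (suc r) → ℚ) → (∀ p → u p zero ≡ 0ℚ) →
    NontrivialRelation (λ i ρ → u (suc i) (suc ρ)) → NontrivialRelation u
  relation-zeroColumn {k} {r} u u≡0 (b , rel , i , bi≢0) = 0ℚ ∷ b , rel′ , suc i , bi≢0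
    where
    rel′ : IsRelation u (0ℚ ∷ b)
    rel′ zero    = sumFin-zeros (suc k) λ i → trans (cong ((0ℚ ∷ b) i *_) (u≡0 i)) (*-zeroʳ ((0ℚ ∷ b) i))
    rel′ (suc ρ) = trans (cong (_+ sumFin k (λ i → b i * u (suc i) (suc ρ))) (*-zeroˡ (u zero (suc ρ))))
                         (trans (+-identityˡ _) (rel ρ))

  -- Eliminate coordinate zero from the other vectors using the pivot vector p.
  relation-pivot : (u : Fin (suc k) → Fin (suc r) → ℚ) (p : Fin (suc k)) → u p zero ≢ 0ℚ →
    NontrivialRelation (λ i ρ → u p zero * u (punchIn p i) (suc ρ) + - (u (punchIn p i) zero * u p (suc ρ))) →
    NontrivialRelation u
  relation-pivot {k} {r} u p c≢0 (b , rel , q , bq≢0) = a , rel′ , punchIn p q , aq≢0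
    where
    open +-*-Solver
    c : ℚ
    c = u p zero
    d : Fin k → ℚ
    d i = u (punchIn p i) zero
    eliminated : Fin k → Fin (suc r) → ℚ
    eliminated i ρ = c * u (punchIn p i) ρ + - (d i * u p ρ)
    S : ℚ
    S = sumFin k (λ i → b i * d i)
    a : Fin (suc k) → ℚ
    a = insertAt (λ i → b i * c) p (- S)
    aq≢0 : a (punchIn p q) ≢ 0ℚ
    aq≢0 rewrite insertAt-punchIn (λ i → b i * c) p (- S) q = *-nonZero bq≢0 c≢0
    combination : ∀ ρ → sumFin (suc k) (λ i → a i * u i ρ) ≡ sumFin k (λ i → b i * eliminated i ρ)
    combination ρ = begin
      sumFin (suc k) (λ i → a i * u i ρ)
        ≡⟨ sumFin-remove k (λ i → a i * u i ρ) p ⟩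
      a p * u p ρ + sumFin k (λ i → a (punchIn p i) * u (punchIn p i) ρ)
        ≡⟨ cong₂ _+_ (cong (_* u p ρ) (insertAt-lookup _ p (- S)))
                     (sumFin-cong k λ i → cong (_* u (punchIn p i) ρ) (insertAt-punchIn _ p (- S) i)) ⟩
      - S * u p ρ + sumFin k (λ i → b i * c * u (punchIn p i) ρ)
        ≡⟨ cong (_+ sumFin k (λ i → b i * c * u (punchIn p i) ρ))
                (trans (reorder₁ S (u p ρ)) (*-distribʳ-sumFin k (- u p ρ) (λ i → b i * d i))) ⟩
      sumFin k (λ i → b i * d i * - u p ρ) + sumFin k (λ i → b i * c * u (punchIn p i) ρ)
        ≡⟨ sumFin-distrib-+ k _ _ ⟨
      sumFin k (λ i → b i * d i * - u p ρ + b i * c * u (punchIn p i) ρ)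
        ≡⟨ sumFin-cong k (λ i → reorder₂ (b i) (d i) (u p ρ) c (u (punchIn p i) ρ)) ⟩
      sumFin k (λ i → b i * eliminated i ρ)
        ∎
      where
      open ≡-Reasoning
      reorder₁ : ∀ s y → - s * y ≡ s * - y
      reorder₁ = solve 2 (λ s y → (:- s) :* y := s :* (:- y)) refl
      reorder₂ : ∀ β δ y γ z → β * δ * - y + β * γ * z ≡ β * (γ * z + - (δ * y))
      reorder₂ = solve 5 (λ β δ y γ z → β :* δ :* (:- y) :+ β :* γ :* z := β :* (γ :* z :+ :- (δ :* y))) refl
    eliminated-zero : ∀ i → eliminated i zero ≡ 0ℚ
    eliminated-zero i = cancel c (d i)
      where
      open +-*-Solver
      cancel : ∀ γ δ → γ * δ + - (δ * γ) ≡ 0ℚ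
      cancel = solve 2 (λ γ δ → γ :* δ :+ :- (δ :* γ) := con 0ℚ) refl
    rel′ : IsRelation u a
    rel′ zero    = trans (combination zero)
                         (sumFin-zeros k λ i → trans (cong (b i *_) (eliminated-zero i)) (*-zeroʳ (b i)))
    rel′ (suc ρ) = trans (combination (suc ρ)) (rel ρ)

  nontrivialRelation : ∀ r (u : Fin (suc r) → Fin r → ℚ) → NontrivialRelation u
  nontrivialRelation zero    u = (λ _ → 1ℚ) , (λ ()) , zero , λ ()
  nontrivialRelation (suc r) u with all? (λ p → u p zero ≟ 0ℚ)
  ... | yes u≡0  = relation-zeroColumn u u≡0 (nontrivialRelation r λ i ρ → u (suc i) (suc ρ))
  ... | no  u≢0 with ¬∀⟶∃¬ _ _ (λ p → u p zero ≟ 0ℚ) u≢0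
  ...   | p , up≢0 = relation-pivot u p up≢0 (nontrivialRelation r λ i ρ →
                       u p zero * u (punchIn p i) (suc ρ) + - (u (punchIn p i) zero * u p (suc ρ)))

  SpanDeterminedBy : (R → C → ℚ) → (Fin r → R) → Set
  SpanDeterminedBy {R} {C} A coord = ∀ {k} (a : Fin k → ℚ) (g : Fin k → C) →
    (∀ ρ → sumFin k (λ i → a i * A (coord ρ) (g i)) ≡ 0ℚ) →
    ∀ e → sumFin k (λ i → a i * A e (g i)) ≡ 0ℚ

  ¬linIndepCols-suc : (A : R → C → ℚ) (coord : Fin r → R) → SpanDeterminedBy A coord →
    (g : Fin (suc r) → C) → ¬ LinIndepCols A (suc r) g
  ¬linIndepCols-suc {r = r} A coord determined g indep
    with nontrivialRelation r (λ i ρ → A (coord ρ) (g i))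
  ... | a , rel , i , ai≢0 = ai≢0 (indep a (determined a g rel) i)

  gram-linIndep : ∀ {n₁ n₂ n₃} (A : R → Fin n₁ × Fin n₂ × Fin n₃ → ℚ) (f : Fin r → R) →
    LinIndepCols (λ t e → A e t) r f → LinIndepCols (λ e e' → ∑³ (λ t → A e t * A e' t)) r f
  gram-linIndep {r = r} {n₁} {n₂} {n₃} A f rowsIndep a comb≡0 = rowsIndep a v≡0
    where
    open +-*-Solver
    v : Fin n₁ × Fin n₂ × Fin n₃ → ℚ
    v t = sumFin r (λ ρ → a ρ * A (f ρ) t)
    reorder : ∀ x y z → x * (y * z) ≡ y * (x * z)
    reorder = solve 3 (λ x y z → x :* (y :* z) := y :* (x :* z)) refl
    A·v≡0 : ∀ e → ∑³ (λ t → A e t * v t) ≡ 0ℚ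
    A·v≡0 e = trans (∑³-cong {n₁} {n₂} {n₃} λ t → trans (*-distribˡ-sumFin r (A e t) _)
                                          (sumFin-cong r λ ρ → reorder (A e t) (a ρ) (A (f ρ) t)))
                    (trans (∑³-linear {n₁} {n₂} {n₃} r a _) (comb≡0 e))
    v·v≡0 : ∑³ (λ t → v t * v t) ≡ 0ℚ
    v·v≡0 = trans (∑³-cong {n₁} {n₂} {n₃} λ t → trans (*-distribʳ-sumFin r (v t) _)
                                        (sumFin-cong r λ ρ → *-assoc (a ρ) (A (f ρ) t) (v t)))
                  (trans (∑³-linear {n₁} {n₂} {n₃} r a _)
                         (sumFin-zeros r λ ρ → trans (cong (a ρ *_) (A·v≡0 (f ρ))) (*-zeroʳ (a ρ))))
    v≡0 : ∀ t → v t ≡ 0ℚ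
    v≡0 t = p*p≡0⇒p≡0 (v t) (∑³-nonNeg-zeros {n₁} {n₂} {n₃} _ (λ t → p*p≥0 (v t)) v·v≡0 t)

module NatArithmetic where
  open import Data.Nat using (ℕ; NonZero; suc; _+_; _*_; _∸_; _^_; _<_)
  open import Data.Nat.Properties using (+-comm; *-comm; +-identityʳ; m+n∸m≡n)
  open import Data.Nat.DivMod
  open import Data.Nat.Solver using (module +-*-Solver)
  open import Relation.Binary.PropositionalEquality
  open +-*-Solver

  [d*q+s]%d≡s : ∀ d .{{_ : NonZero d}} q {s} → s < d → (d * q + s) % d ≡ s
  [d*q+s]%d≡s d q {s} s<d = begin
    (d * q + s) % d  ≡⟨ %-congˡ (trans (+-comm (d * q) s) (cong (s +_) (*-comm d q))) ⟩
    (s + q * d) % d  ≡⟨ [m+kn]%n≡m%n s q d ⟩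
    s % d            ≡⟨ m<n⇒m%n≡m s<d ⟩
    s                ∎
    where open ≡-Reasoning

  [d*q+s]/d≡q : ∀ d .{{_ : NonZero d}} q {s} → s < d → (d * q + s) / d ≡ q
  [d*q+s]/d≡q d q {s} s<d = begin
    (d * q + s) / d    ≡⟨ /-congˡ (trans (+-comm (d * q) s) (cong (s +_) (*-comm d q))) ⟩
    (s + q * d) / d    ≡⟨ +-distrib-/ s (q * d) remainders<d ⟩
    s / d + q * d / d  ≡⟨ cong₂ _+_ (m<n⇒m/n≡0 s<d) (m*n/n≡m q d) ⟩
    q                  ∎
    where
    open ≡-Reasoning
    remainders<d : s % d + q * d % d < d
    remainders<d = subst (_< d) (sym (trans (cong₂ _+_ (m<n⇒m%n≡m s<d) (m*n%n≡0 q d)) (+-identityʳ s))) s<d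

  /-%-injective : ∀ d .{{_ : NonZero d}} {a b} → a / d ≡ b / d → a % d ≡ b % d → a ≡ b
  /-%-injective d {a} {b} a/d≡b/d a%d≡b%d = begin
    a                  ≡⟨ m≡m%n+[m/n]*n a d ⟩
    a % d + a / d * d  ≡⟨ cong₂ (λ r q → r + q * d) a%d≡b%d a/d≡b/d ⟩
    b % d + b / d * d  ≡⟨ m≡m%n+[m/n]*n b d ⟨
    b                  ∎
    where open ≡-Reasoning


  [1+x]³∸x³ : ∀ x → suc x ^ 3 ∸ x ^ 3 ≡ suc x * suc x + (suc x * x + x * x)
  [1+x]³∸x³ x = trans (cong (_∸ x ^ 3) (expand x)) (m+n∸m≡n (x ^ 3) _)
    where
    expand : ∀ x → suc x ^ 3 ≡ x ^ 3 + (suc x * suc x + (suc x * x + x * x))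
    expand = solve 1 (λ x → (con 1 :+ x) :^ 3
                        := x :^ 3 :+ ((con 1 :+ x) :* (con 1 :+ x) :+ ((con 1 :+ x) :* x :+ x :* x))) refl

  rank-count : ∀ x a b → suc x ^ 3 ∸ x ^ 3 + x * a * b ≡ suc x * suc x + (suc x * x + (x * x + x * (b * a)))
  rank-count x a b = trans (cong (_+ x * a * b) ([1+x]³∸x³ x)) (regroup x a b)
    where
    regroup : ∀ x a b → suc x * suc x + (suc x * x + x * x) + x * a * b
                        ≡ suc x * suc x + (suc x * x + (x * x + x * (b * a)))
    regroup = solve 3 (λ x a b → (con 1 :+ x) :* (con 1 :+ x) :+ ((con 1 :+ x) :* x :+ x :* x) :+ x :* a :* b
                              := (con 1 :+ x) :* (con 1 :+ x) :+ ((con 1 :+ x) :* x :+ (x :* x :+ x :* (b :* a)))) refl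

module Tiling (h' w' : ℕ) where
  open FiniteSums
  open LinearAlgebra
  open NatArithmetic
  open import Data.Nat as ℕ using (ℕ; zero; suc; _∸_; s≤s; z≤n; s<s⁻¹)
  open import Data.Nat.Properties as ℕ using (+-monoʳ-<; *-monoʳ-<; *-monoʳ-≤; *-suc)
  open import Data.Nat.DivMod using (_/_; _%_; m<n*o⇒m/o<n; m*n/n≡m; m%n<n)
  open import Data.Fin as Fin using (Fin; zero; suc; toℕ; fromℕ<)
  open import Data.Fin.Properties using (toℕ<n; toℕ-fromℕ<; toℕ-injective; suc-injective; 0≢1+n; +↔⊎; *↔×)
  open import Data.Product using (∃₂; _×_; _,_; proj₁; proj₂; map₁)
  open import Data.Sum using (_⊎_; inj₁; inj₂; [_,_]′)
  import Data.Sum as Sum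
  open import Data.Empty using (⊥-elim)
  open import Data.Bool using (_∧_)
  open import Data.Bool.Properties using (∧-zeroʳ)
  open import Data.Rational using (ℚ; 0ℚ; 1ℚ; _+_; _*_; -_)
  open import Relation.Nullary using (Dec; yes; no; does)
  open import Relation.Nullary.Decidable using (dec-true; dec-false)
  open import Data.Rational.Properties using (*-identityʳ; *-zeroˡ; *-zeroʳ; *-comm)
  open import Data.Rational.Solver using (module +-*-Solver)
  open import Function using (_∘_)
  open import Function.Bundles using (_↔_; Inverse; Injection)
  open import Function.Properties.Inverse using (↔-trans; ↔-refl; ↔⇒↣)
  open import Data.Sum.Function.Propositional using (_⊎-↔_)
  open import Data.Product.Function.NonDependent.Propositional using (_×-↔_)
  open import Relation.Binary.PropositionalEquality

  h w n m : ℕ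
  h = suc (suc h')
  w = suc (suc w')
  n = h ℕ.* w
  m = n ∸ 1   -- n reduces to a successor, so Fin (suc m) is definitionally Fin n

  E T : Set
  E = Edge n
  T = Tile n

  i/h<w : (i : Fin n) → toℕ i / h ℕ.< w
  i/h<w i = m<n*o⇒m/o<n (subst (toℕ i ℕ.<_) (ℕ.*-comm h w) (toℕ<n i))

  j/w<h : (j : Fin n) → toℕ j / w ℕ.< h
  j/w<h j = m<n*o⇒m/o<n (toℕ<n j)

  box0<n : (i j : Fin n) → box0 h w (toℕ i) (toℕ j) ℕ.< n
  box0<n i j = begin-strict
    h ℕ.* (toℕ i / h) ℕ.+ toℕ j / w  <⟨ +-monoʳ-< (h ℕ.* (toℕ i / h)) (j/w<h j) ⟩
    h ℕ.* (toℕ i / h) ℕ.+ h          ≡⟨ ℕ.+-comm (h ℕ.* (toℕ i / h)) h ⟩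
    h ℕ.+ h ℕ.* (toℕ i / h)          ≡⟨ *-suc h (toℕ i / h) ⟨
    h ℕ.* suc (toℕ i / h)            ≤⟨ *-monoʳ-≤ h (i/h<w i) ⟩
    n                                ∎
    where open ℕ.≤-Reasoning

  box : Fin n → Fin n → Fin n
  box i j = fromℕ< (box0<n i j)

  box-quotient : ∀ i j → toℕ (box i j) / h ≡ toℕ i / h
  box-quotient i j = trans (cong (_/ h) (toℕ-fromℕ< (box0<n i j))) ([d*q+s]/d≡q h (toℕ i / h) (j/w<h j))

  box-remainder : ∀ i j → toℕ (box i j) % h ≡ toℕ j / w
  box-remainder i j = trans (cong (_% h) (toℕ-fromℕ< (box0<n i j))) ([d*q+s]%d≡s h (toℕ i / h) (j/w<h j))

  h*[1+β]<n : (β : Fin (suc w')) → h ℕ.* suc (toℕ β) ℕ.< n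
  h*[1+β]<n β = *-monoʳ-< h (s≤s (toℕ<n β))

  w*[1+σ]<n : (σ : Fin (suc h')) → w ℕ.* suc (toℕ σ) ℕ.< n
  w*[1+σ]<n σ = subst (w ℕ.* suc (toℕ σ) ℕ.<_) (ℕ.*-comm w h) (*-monoʳ-< w (s≤s (toℕ<n σ)))

  -- The boxes outside the first row band and the first column band, each named after
  -- its top-left cell (h (β + 1), w (σ + 1)).
  specialRow : Fin (suc w') → Fin n
  specialRow β = fromℕ< (h*[1+β]<n β)

  specialCol : Fin (suc h') → Fin n
  specialCol σ = fromℕ< (w*[1+σ]<n σ)

  specialBox : Fin (suc w') → Fin (suc h') → Fin n
  specialBox β σ = box (specialRow β) (specialCol σ)

  specialBox-quotient : ∀ β σ → toℕ (specialBox β σ) / h ≡ suc (toℕ β)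
  specialBox-quotient β σ = begin
    toℕ (specialBox β σ) / h       ≡⟨ box-quotient (specialRow β) (specialCol σ) ⟩
    toℕ (specialRow β) / h         ≡⟨ cong (_/ h) (toℕ-fromℕ< (h*[1+β]<n β)) ⟩
    h ℕ.* suc (toℕ β) / h          ≡⟨ cong (_/ h) (ℕ.*-comm h (suc (toℕ β))) ⟩
    suc (toℕ β) ℕ.* h / h          ≡⟨ m*n/n≡m (suc (toℕ β)) h ⟩
    suc (toℕ β)                    ∎
    where open ≡-Reasoning

  specialBox-remainder : ∀ β σ → toℕ (specialBox β σ) % h ≡ suc (toℕ σ)
  specialBox-remainder β σ = begin
    toℕ (specialBox β σ) % h       ≡⟨ box-remainder (specialRow β) (specialCol σ) ⟩
    toℕ (specialCol σ) / w         ≡⟨ cong (_/ w) (toℕ-fromℕ< (w*[1+σ]<n σ)) ⟩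
    w ℕ.* suc (toℕ σ) / w          ≡⟨ cong (_/ w) (ℕ.*-comm w (suc (toℕ σ))) ⟩
    suc (toℕ σ) ℕ.* w / w          ≡⟨ m*n/n≡m (suc (toℕ σ)) w ⟩
    suc (toℕ σ)                    ∎
    where open ≡-Reasoning

  specialBox-injective : ∀ {β β' σ σ'} → specialBox β σ ≡ specialBox β' σ' → β ≡ β' × σ ≡ σ'
  specialBox-injective {β} {β'} {σ} {σ'} eq =
    toℕ-injective (ℕ.suc-injective (begin
      suc (toℕ β)                ≡⟨ specialBox-quotient β σ ⟨
      toℕ (specialBox β σ) / h   ≡⟨ cong (λ b → toℕ b / h) eq ⟩
      toℕ (specialBox β' σ') / h ≡⟨ specialBox-quotient β' σ' ⟩
      suc (toℕ β')               ∎)) ,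
    toℕ-injective (ℕ.suc-injective (begin
      suc (toℕ σ)                ≡⟨ specialBox-remainder β σ ⟨
      toℕ (specialBox β σ) % h   ≡⟨ cong (λ b → toℕ b % h) eq ⟩
      toℕ (specialBox β' σ') % h ≡⟨ specialBox-remainder β' σ' ⟩
      suc (toℕ σ')               ∎))
    where open ≡-Reasoning

  specialBox≢box-row₀ : ∀ β σ j → specialBox β σ ≢ box zero j
  specialBox≢box-row₀ β σ j eq =
    ℕ.1+n≢0 (trans (sym (specialBox-quotient β σ)) (trans (cong (λ b → toℕ b / h) eq) (box-quotient zero j)))

  specialBox≢box-col₀ : ∀ β σ i → specialBox β σ ≢ box i zero
  specialBox≢box-col₀ β σ i eq =
    ℕ.1+n≢0 (trans (sym (specialBox-remainder β σ)) (trans (cong (λ b → toℕ b % h) eq) (box-remainder i zero)))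

  specialBox-surjective : ∀ b → toℕ b / h ≢ 0 → toℕ b % h ≢ 0 → ∃₂ λ β σ → specialBox β σ ≡ b
  specialBox-surjective b q≢0 r≢0 =
    fromℕ< β<w' , fromℕ< σ<h' , toℕ-injective (/-%-injective h same-quotient same-remainder)
    where
    q r : ℕ
    q = toℕ b / h
    r = toℕ b % h
    instance
      _ = ℕ.≢-nonZero q≢0
      _ = ℕ.≢-nonZero r≢0
    β<w' : ℕ.pred q ℕ.< suc w'
    β<w' = s<s⁻¹ (subst (ℕ._< w) (sym (ℕ.suc-pred q)) (i/h<w b))
    σ<h' : ℕ.pred r ℕ.< suc h'
    σ<h' = s<s⁻¹ (subst (ℕ._< h) (sym (ℕ.suc-pred r)) (m%n<n (toℕ b) h))
    same-quotient : toℕ (specialBox (fromℕ< β<w') (fromℕ< σ<h')) / h ≡ q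
    same-quotient = trans (specialBox-quotient (fromℕ< β<w') (fromℕ< σ<h'))
                          (trans (cong suc (toℕ-fromℕ< β<w')) (ℕ.suc-pred q))
    same-remainder : toℕ (specialBox (fromℕ< β<w') (fromℕ< σ<h')) % h ≡ r
    same-remainder = trans (specialBox-remainder (fromℕ< β<w') (fromℕ< σ<h'))
                           (trans (cong suc (toℕ-fromℕ< σ<h')) (ℕ.suc-pred r))

  ends : EdgeKind → T → Fin n × Fin n
  ends rc (i , j , k) = i , j
  ends rs (i , j , k) = i , k
  ends cs (i , j , k) = j , k
  ends bs (i , j , k) = box i j , k

  W-ends : ∀ κ t → W h w (κ , ends κ t) t ≡ 1ℚ
  W-ends rc (i , j , k) rewrite dec-true (i Fin.≟ i) refl | dec-true (j Fin.≟ j) refl = refl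
  W-ends rs (i , j , k) rewrite dec-true (i Fin.≟ i) refl | dec-true (k Fin.≟ k) refl = refl
  W-ends cs (i , j , k) rewrite dec-true (j Fin.≟ j) refl | dec-true (k Fin.≟ k) refl = refl
  W-ends bs (i , j , k)
    rewrite dec-true (toℕ (box i j) ℕ.≟ box0 h w (toℕ i) (toℕ j)) (toℕ-fromℕ< (box0<n i j))
          | dec-true (k Fin.≟ k) refl = refl

  W-support : ∀ κ a b t → W h w (κ , a , b) t ≡ 0ℚ ⊎ (a , b) ≡ ends κ t
  W-support rc a b (i , j , k) with a Fin.≟ i | b Fin.≟ j
  ... | yes refl | yes refl = inj₂ refl
  ... | yes _    | no _     = inj₁ refl
  ... | no _     | _        = inj₁ refl
  W-support rs a b (i , j , k) with a Fin.≟ i | b Fin.≟ k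
  ... | yes refl | yes refl = inj₂ refl
  ... | yes _    | no _     = inj₁ refl
  ... | no _     | _        = inj₁ refl
  W-support cs a b (i , j , k) with a Fin.≟ j | b Fin.≟ k
  ... | yes refl | yes refl = inj₂ refl
  ... | yes _    | no _     = inj₁ refl
  ... | no _     | _        = inj₁ refl
  W-support bs a b (i , j , k) with toℕ a ℕ.≟ box0 h w (toℕ i) (toℕ j) | b Fin.≟ k
  ... | yes a≡box | yes refl = inj₂ (cong (_, b) (toℕ-injective (trans a≡box (sym (toℕ-fromℕ< (box0<n i j))))))
  ... | yes _     | no _     = inj₁ (cong indicator (∧-zeroʳ _))
  ... | no a≢box  | b≟k      =
    inj₁ (cong (λ x → indicator (x ∧ does b≟k)) (dec-false (toℕ a ℕ.≟ box0 h w (toℕ i) (toℕ j)) a≢box))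


  kindOf : Fin 4 → EdgeKind
  kindOf zero                   = rc
  kindOf (suc zero)             = rs
  kindOf (suc (suc zero))       = cs
  kindOf (suc (suc (suc zero))) = bs

  kindIndex : EdgeKind → Fin 4
  kindIndex rc = zero
  kindIndex rs = suc zero
  kindIndex cs = suc (suc zero)
  kindIndex bs = suc (suc (suc zero))

  kindIndex-kindOf : ∀ q → kindIndex (kindOf q) ≡ q
  kindIndex-kindOf zero                   = refl
  kindIndex-kindOf (suc zero)             = refl
  kindIndex-kindOf (suc (suc zero))       = refl
  kindIndex-kindOf (suc (suc (suc zero))) = refl

  kindOf-kindIndex : ∀ κ → kindOf (kindIndex κ) ≡ κ
  kindOf-kindIndex rc = refl
  kindOf-kindIndex rs = refl
  kindOf-kindIndex cs = refl
  kindOf-kindIndex bs = refl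

  ∑ₑ : (E → ℚ) → ℚ
  ∑ₑ f = ∑³ (f ∘ map₁ kindOf)

  ∑ₑ-cong : {f g : E → ℚ} → (∀ e → f e ≡ g e) → ∑ₑ f ≡ ∑ₑ g
  ∑ₑ-cong f≗g = ∑³-cong {4} {n} {n} (f≗g ∘ map₁ kindOf)

  ∑ₑ-linear : ∀ r (c : Fin r → ℚ) (f : Fin r → E → ℚ) →
    ∑ₑ (λ e → sumFin r (λ i → c i * f i e)) ≡ sumFin r (λ i → c i * ∑ₑ (f i))
  ∑ₑ-linear r c f = ∑³-linear {4} {n} {n} r c (λ i → f i ∘ map₁ kindOf)

  *-distribˡ-∑ₑ : ∀ x (f : E → ℚ) → x * ∑ₑ f ≡ ∑ₑ (λ e → x * f e)
  *-distribˡ-∑ₑ x f = *-distribˡ-∑³ {4} {n} {n} x (f ∘ map₁ kindOf)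

  ∑ₑ-comm-∑³ : (f : E → T → ℚ) → ∑ₑ (λ e → ∑³ (f e)) ≡ ∑³ (λ t → ∑ₑ (λ e → f e t))
  ∑ₑ-comm-∑³ f = ∑³-comm {4} {n} {n} {n} {n} {n} (f ∘ map₁ kindOf)

  ∑ₑ-single : (f : E → ℚ) (e₀ : E) → (∀ e → e ≢ e₀ → f e ≡ 0ℚ) → ∑ₑ f ≡ f e₀
  ∑ₑ-single f (κ , a , b) f≡0 =
    trans (∑³-single (f ∘ map₁ kindOf) (kindIndex κ , a , b) off)
          (cong (λ κ' → f (κ' , a , b)) (kindOf-kindIndex κ))
    where
    off : ∀ t → t ≢ (kindIndex κ , a , b) → f (map₁ kindOf t) ≡ 0ℚ
    off (q , a' , b') t≢ = f≡0 _ λ eq →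
      t≢ (trans (cong (λ q → q , a' , b') (sym (kindIndex-kindOf q))) (cong (map₁ kindIndex) eq))

  ∑ₑ-column : ∀ (κ : E → ℚ) t →
    ∑ₑ (λ e → κ e * W h w e t) ≡ sumFin 4 (λ q → κ (kindOf q , ends (kindOf q) t))
  ∑ₑ-column κ t = sumFin-cong 4 λ q → on-kind (kindOf q)
    where
    on-kind : ∀ k → sumFin n (λ a → sumFin n (λ b → κ (k , a , b) * W h w (k , a , b) t)) ≡ κ (k , ends k t)
    on-kind k = trans (sumFin²-single n n _ (proj₁ (ends k t)) (proj₂ (ends k t)) off)
                      (trans (cong (κ (k , ends k t) *_) (W-ends k t)) (*-identityʳ _))
      where
      off : ∀ a b → (a , b) ≢ ends k t → κ (k , a , b) * W h w (k , a , b) t ≡ 0ℚ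
      off a b ab≢ends with W-support k a b t
      ... | inj₁ W≡0    = trans (cong (κ (k , a , b) *_) W≡0) (*-zeroʳ (κ (k , a , b)))
      ... | inj₂ ab≡ends = ⊥-elim (ab≢ends ab≡ends)

  LeftNull : (E → ℚ) → Set
  LeftNull κ = ∀ t → ∑ₑ (λ e → κ e * W h w e t) ≡ 0ℚ

  tileSums⇒LeftNull : (κ : E → ℚ) → (∀ t → sumFin 4 (λ q → κ (kindOf q , ends (kindOf q) t)) ≡ 0ℚ) → LeftNull κ
  tileSums⇒LeftNull κ null t = trans (∑ₑ-column κ t) (null t)

  -- The column space of W, described as the annihilator of the left null space.
  ⊥LeftNull : (E → ℚ) → Set
  ⊥LeftNull x = ∀ κ → LeftNull κ → ∑ₑ (λ e → κ e * x e) ≡ 0ℚ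

  ⊥LeftNull-W : ∀ t → ⊥LeftNull (λ e → W h w e t)
  ⊥LeftNull-W t κ null = null t

  ⊥LeftNull-cong : {x y : E → ℚ} → (∀ e → x e ≡ y e) → ⊥LeftNull x → ⊥LeftNull y
  ⊥LeftNull-cong x≗y x⊥ κ null = trans (∑ₑ-cong λ e → cong (κ e *_) (sym (x≗y e))) (x⊥ κ null)

  private
    reorder : ∀ p q r → p * (q * r) ≡ q * (p * r)
    reorder = solve 3 (λ p q r → p :* (q :* r) := q :* (p :* r)) refl
      where open +-*-Solver

  ⊥LeftNull-sumFin : ∀ r (a : Fin r → ℚ) (x : Fin r → E → ℚ) → (∀ i → ⊥LeftNull (x i)) →
    ⊥LeftNull (λ e → sumFin r (λ i → a i * x i e))
  ⊥LeftNull-sumFin r a x x⊥ κ null = begin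
    ∑ₑ (λ e → κ e * sumFin r (λ i → a i * x i e))
      ≡⟨ ∑ₑ-cong (λ e → trans (*-distribˡ-sumFin r (κ e) _) (sumFin-cong r λ i → reorder (κ e) (a i) (x i e))) ⟩
    ∑ₑ (λ e → sumFin r (λ i → a i * (κ e * x i e)))
      ≡⟨ ∑ₑ-linear r a (λ i e → κ e * x i e) ⟩
    sumFin r (λ i → a i * ∑ₑ (λ e → κ e * x i e))
      ≡⟨ sumFin-zeros r (λ i → trans (cong (a i *_) (x⊥ i κ null)) (*-zeroʳ (a i))) ⟩
    0ℚ
      ∎
    where open ≡-Reasoning

  ⊥LeftNull-∑³ : (c : T → ℚ) (x : T → E → ℚ) → (∀ t → ⊥LeftNull (x t)) →
    ⊥LeftNull (λ e → ∑³ (λ t → c t * x t e))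
  ⊥LeftNull-∑³ c x x⊥ κ null = begin
    ∑ₑ (λ e → κ e * ∑³ (λ t → c t * x t e))
      ≡⟨ ∑ₑ-cong (λ e → trans (*-distribˡ-∑³ {n} {n} {n} (κ e) (λ t → c t * x t e))
                              (∑³-cong {n} {n} {n} λ t → reorder (κ e) (c t) (x t e))) ⟩
    ∑ₑ (λ e → ∑³ (λ t → c t * (κ e * x t e)))
      ≡⟨ ∑ₑ-comm-∑³ (λ e t → c t * (κ e * x t e)) ⟩
    ∑³ (λ t → ∑ₑ (λ e → c t * (κ e * x t e)))
      ≡⟨ ∑³-cong {n} {n} {n} (λ t → sym (*-distribˡ-∑ₑ (c t) (λ e → κ e * x t e))) ⟩
    ∑³ (λ t → c t * ∑ₑ (λ e → κ e * x t e))
      ≡⟨ ∑³-zeros {n} {n} {n} (λ t → trans (cong (c t *_) (x⊥ t κ null)) (*-zeroʳ (c t))) ⟩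
    0ℚ
      ∎
    where open ≡-Reasoning

  ⊥LeftNull-M : ∀ e' → ⊥LeftNull (λ e → M h w e e')
  ⊥LeftNull-M e' = ⊥LeftNull-cong (λ e → ∑³-cong {n} {n} {n} λ t → *-comm (W h w e' t) (W h w e t))
                     (⊥LeftNull-∑³ (W h w e') (λ t e → W h w e t) ⊥LeftNull-W)

  δ : ℕ → ℕ → ℚ
  δ a b = indicator (does (a ℕ.≟ b))

  δ-refl : ∀ a → δ a a ≡ 1ℚ
  δ-refl a = cong indicator (dec-true (a ℕ.≟ a) refl)

  δ≡0 : ∀ {a b} → a ≢ b → δ a b ≡ 0ℚ
  δ≡0 {a} {b} a≢b = cong indicator (dec-false (a ℕ.≟ b) a≢b)

  δ-cases : ∀ a b → δ a b ≡ 0ℚ ⊎ a ≡ b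
  δ-cases a b with a ℕ.≟ b
  ... | yes a≡b = inj₂ a≡b
  ... | no  a≢b = inj₁ (δ≡0 a≢b)

  -δ≡0 : ∀ {a b} → a ≢ b → - δ a b ≡ 0ℚ
  -δ≡0 = cong -_ ∘ δ≡0

  -δ≢0 : ∀ a → - δ a a ≢ 0ℚ
  -δ≢0 a = subst (λ y → - y ≢ 0ℚ) (sym (δ-refl a)) λ ()

  -δ*δ≢0 : ∀ a b → - (δ a a * δ b b) ≢ 0ℚ
  -δ*δ≢0 a b = subst₂ (λ y z → - (y * z) ≢ 0ℚ) (sym (δ-refl a)) (sym (δ-refl b)) λ ()

  -[x*y]≡0 : ∀ {x y} → x ≡ 0ℚ ⊎ y ≡ 0ℚ → - (x * y) ≡ 0ℚ
  -[x*y]≡0 {y = y} (inj₁ x≡0) = cong -_ (trans (cong (_* y) x≡0) (*-zeroˡ y))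
  -[x*y]≡0 {x = x} (inj₂ y≡0) = cong -_ (trans (cong (x *_) y≡0) (*-zeroʳ x))

  -- The sum over the four kinds in tileSums⇒LeftNull unfolds to x₀ + (x₁ + (x₂ + (x₃ + 0ℚ))).
  private
    open +-*-Solver
    cancel-rc-rs : ∀ y → y + (- y + (0ℚ + (0ℚ + 0ℚ))) ≡ 0ℚ
    cancel-rc-rs = solve 1 (λ y → y :+ (:- y :+ (con 0ℚ :+ (con 0ℚ :+ con 0ℚ))) := con 0ℚ) refl
    cancel-rc-cs : ∀ y → y + (0ℚ + (- y + (0ℚ + 0ℚ))) ≡ 0ℚ
    cancel-rc-cs = solve 1 (λ y → y :+ (con 0ℚ :+ (:- y :+ (con 0ℚ :+ con 0ℚ))) := con 0ℚ) refl
    cancel-rs-cs : ∀ y → 0ℚ + (y + (- y + (0ℚ + 0ℚ))) ≡ 0ℚ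
    cancel-rs-cs = solve 1 (λ y → con 0ℚ :+ (y :+ (:- y :+ (con 0ℚ :+ con 0ℚ))) := con 0ℚ) refl
    cancel-cs-bs : ∀ y → 0ℚ + (0ℚ + (y + (- y + 0ℚ))) ≡ 0ℚ
    cancel-cs-bs = solve 1 (λ y → con 0ℚ :+ (con 0ℚ :+ (y :+ (:- y :+ con 0ℚ))) := con 0ℚ) refl
    cancel-rs-bs : ∀ y → 0ℚ + (y + (0ℚ + (- y + 0ℚ))) ≡ 0ℚ
    cancel-rs-bs = solve 1 (λ y → con 0ℚ :+ (y :+ (con 0ℚ :+ (:- y :+ con 0ℚ))) := con 0ℚ) refl
    cancel-rc-bs : ∀ y → y + (0ℚ + (0ℚ + (- y + 0ℚ))) ≡ 0ℚ
    cancel-rc-bs = solve 1 (λ y → y :+ (con 0ℚ :+ (con 0ℚ :+ (:- y :+ con 0ℚ))) := con 0ℚ) refl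

  -- Each relation equates two ways of counting the tiles that contain a given vertex,
  -- or a given symbol within a band.
  rowRelation : Fin n → E → ℚ
  rowRelation i (rc , a , _) = δ (toℕ a) (toℕ i)
  rowRelation i (rs , a , _) = - δ (toℕ a) (toℕ i)
  rowRelation i (cs , _ , _) = 0ℚ
  rowRelation i (bs , _ , _) = 0ℚ

  colRelation : Fin n → E → ℚ
  colRelation j (rc , _ , b) = δ (toℕ b) (toℕ j)
  colRelation j (rs , _ , _) = 0ℚ
  colRelation j (cs , a , _) = - δ (toℕ a) (toℕ j)
  colRelation j (bs , _ , _) = 0ℚ

  symbolRelation : Fin n → E → ℚ
  symbolRelation k (rc , _ , _) = 0ℚ
  symbolRelation k (rs , _ , c) = δ (toℕ c) (toℕ k)
  symbolRelation k (cs , _ , c) = - δ (toℕ c) (toℕ k)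
  symbolRelation k (bs , _ , _) = 0ℚ

  colBandRelation : ℕ → Fin n → E → ℚ
  colBandRelation σ k (rc , _ , _) = 0ℚ
  colBandRelation σ k (rs , _ , _) = 0ℚ
  colBandRelation σ k (cs , a , c) = δ (toℕ a / w) σ * δ (toℕ c) (toℕ k)
  colBandRelation σ k (bs , a , c) = - (δ (toℕ a % h) σ * δ (toℕ c) (toℕ k))

  rowBandRelation : ℕ → Fin n → E → ℚ
  rowBandRelation β k (rc , _ , _) = 0ℚ
  rowBandRelation β k (rs , a , c) = δ (toℕ a / h) β * δ (toℕ c) (toℕ k)
  rowBandRelation β k (cs , _ , _) = 0ℚ
  rowBandRelation β k (bs , a , c) = - (δ (toℕ a / h) β * δ (toℕ c) (toℕ k))

  boxRelation : Fin n → E → ℚ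
  boxRelation b (rc , i , j) = δ (toℕ (box i j)) (toℕ b)
  boxRelation b (rs , _ , _) = 0ℚ
  boxRelation b (cs , _ , _) = 0ℚ
  boxRelation b (bs , a , _) = - δ (toℕ a) (toℕ b)

  rowRelation-null : ∀ i → LeftNull (rowRelation i)
  rowRelation-null i = tileSums⇒LeftNull (rowRelation i) λ (ti , _ , _) → cancel-rc-rs (δ (toℕ ti) (toℕ i))

  colRelation-null : ∀ j → LeftNull (colRelation j)
  colRelation-null j = tileSums⇒LeftNull (colRelation j) λ (_ , tj , _) → cancel-rc-cs (δ (toℕ tj) (toℕ j))

  symbolRelation-null : ∀ k → LeftNull (symbolRelation k)
  symbolRelation-null k = tileSums⇒LeftNull (symbolRelation k) λ (_ , _ , tk) → cancel-rs-cs (δ (toℕ tk) (toℕ k))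

  colBandRelation-null : ∀ σ k → LeftNull (colBandRelation σ k)
  colBandRelation-null σ k = tileSums⇒LeftNull (colBandRelation σ k) λ (ti , tj , tk) →
    let y = δ (toℕ tj / w) σ * δ (toℕ tk) (toℕ k) in
    subst (λ r → 0ℚ + (0ℚ + (y + (- (δ r σ * δ (toℕ tk) (toℕ k)) + 0ℚ))) ≡ 0ℚ)
          (sym (box-remainder ti tj)) (cancel-cs-bs y)

  rowBandRelation-null : ∀ β k → LeftNull (rowBandRelation β k)
  rowBandRelation-null β k = tileSums⇒LeftNull (rowBandRelation β k) λ (ti , tj , tk) →
    let y = δ (toℕ ti / h) β * δ (toℕ tk) (toℕ k) in
    subst (λ q → 0ℚ + (y + (0ℚ + (- (δ q β * δ (toℕ tk) (toℕ k)) + 0ℚ))) ≡ 0ℚ)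
          (sym (box-quotient ti tj)) (cancel-rs-bs y)

  boxRelation-null : ∀ b → LeftNull (boxRelation b)
  boxRelation-null b = tileSums⇒LeftNull (boxRelation b) λ (ti , tj , _) → cancel-rc-bs (δ (toℕ (box ti tj)) (toℕ b))

  Index : Set
  Index = (Fin n × Fin n) ⊎ (Fin n × Fin m) ⊎ (Fin m × Fin m) ⊎ (Fin m × Fin (suc w') × Fin (suc h'))

  pattern block₁ a b   = inj₁ (a , b)
  pattern block₂ a b   = inj₂ (inj₁ (a , b))
  pattern block₃ a b   = inj₂ (inj₂ (inj₁ (a , b)))
  pattern block₄ k β σ = inj₂ (inj₂ (inj₂ (k , β , σ)))

  basisEdgeAt : Index → E
  basisEdgeAt (block₁ i j)   = rc , i , j
  basisEdgeAt (block₂ i k)   = rs , i , suc k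
  basisEdgeAt (block₃ j k)   = cs , suc j , suc k
  basisEdgeAt (block₄ k β σ) = bs , specialBox β σ , suc k

  module Vanishing (x : E → ℚ) (x⊥ : ⊥LeftNull x) (x≡0 : ∀ z → x (basisEdgeAt z) ≡ 0ℚ) where

    isolate : ∀ κ e₀ → LeftNull κ → κ e₀ ≢ 0ℚ → (∀ e → e ≢ e₀ → κ e ≡ 0ℚ ⊎ x e ≡ 0ℚ) →
      x e₀ ≡ 0ℚ
    isolate κ e₀ null κ₀≢0 supported =
      p*q≡0⇒q≡0 (κ e₀) (x e₀) κ₀≢0 (trans (sym (∑ₑ-single (λ e → κ e * x e) e₀ term≡0)) (x⊥ κ null))
      where
      term≡0 : ∀ e → e ≢ e₀ → κ e * x e ≡ 0ℚ
      term≡0 e e≢e₀ with supported e e≢e₀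
      ... | inj₁ κ≡0 = trans (cong (_* x e) κ≡0) (*-zeroˡ (x e))
      ... | inj₂ x≡0 = trans (cong (κ e *_) x≡0) (*-zeroʳ (κ e))

    x-rs≡0 : ∀ (i k : Fin n) → x (rs , i , k) ≡ 0ℚ
    x-rs≡0 i (suc k) = x≡0 (block₂ i k)
    x-rs≡0 i zero    = isolate (rowRelation i) (rs , i , zero) (rowRelation-null i) (-δ≢0 (toℕ i)) supported
      where
      supported : ∀ e → e ≢ (rs , i , zero) → rowRelation i e ≡ 0ℚ ⊎ x e ≡ 0ℚ
      supported (rc , a , b)     _    = inj₂ (x≡0 (block₁ a b))
      supported (rs , a , suc k) _    = inj₂ (x≡0 (block₂ a k))
      supported (rs , a , zero)  e≢e₀ = inj₁ (-δ≡0 (e≢e₀ ∘ cong (λ a → rs , a , zero) ∘ toℕ-injective))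
      supported (cs , _ , _)     _    = inj₁ refl
      supported (bs , _ , _)     _    = inj₁ refl

    x-cs-suc≡0 : ∀ (j : Fin m) (k : Fin n) → x (cs , suc j , k) ≡ 0ℚ
    x-cs-suc≡0 j (suc k) = x≡0 (block₃ j k)
    x-cs-suc≡0 j zero    =
      isolate (colRelation (suc j)) (cs , suc j , zero) (colRelation-null (suc j)) (-δ≢0 (toℕ (suc j))) supported
      where
      supported : ∀ e → e ≢ (cs , suc j , zero) → colRelation (suc j) e ≡ 0ℚ ⊎ x e ≡ 0ℚ
      supported (rc , a , b)         _    = inj₂ (x≡0 (block₁ a b))
      supported (rs , _ , _)         _    = inj₁ refl
      supported (cs , zero , _)      _    = inj₁ refl
      supported (cs , suc a , suc k) _    = inj₂ (x≡0 (block₃ a k))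
      supported (cs , suc a , zero)  e≢e₀ = inj₁ (-δ≡0 (e≢e₀ ∘ cong (λ a → cs , a , zero) ∘ toℕ-injective))
      supported (bs , _ , _)         _    = inj₁ refl

    x-cs≡0 : ∀ (j k : Fin n) → x (cs , j , k) ≡ 0ℚ
    x-cs≡0 (suc j) k = x-cs-suc≡0 j k
    x-cs≡0 zero    k = isolate (symbolRelation k) (cs , zero , k) (symbolRelation-null k) (-δ≢0 (toℕ k)) supported
      where
      supported : ∀ e → e ≢ (cs , zero , k) → symbolRelation k e ≡ 0ℚ ⊎ x e ≡ 0ℚ
      supported (rc , _ , _)     _    = inj₁ refl
      supported (rs , a , c)     _    = inj₂ (x-rs≡0 a c)
      supported (cs , suc a , c) _    = inj₂ (x-cs-suc≡0 a c)
      supported (cs , zero , c)  e≢e₀ = inj₁ (-δ≡0 (e≢e₀ ∘ cong (λ c → cs , zero , c) ∘ toℕ-injective))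
      supported (bs , _ , _)     _    = inj₁ refl

    x-bs-special≡0 : ∀ (b : Fin n) (k : Fin m) → toℕ b / h ≢ 0 → toℕ b % h ≢ 0 → x (bs , b , suc k) ≡ 0ℚ
    x-bs-special≡0 b k q≢0 r≢0 =
      let β , σ , special≡b = specialBox-surjective b q≢0 r≢0
      in subst (λ b → x (bs , b , suc k) ≡ 0ℚ) special≡b (x≡0 (block₄ k β σ))

    band-supported : ∀ (band : Fin n → ℕ) v (b : Fin n) (k : Fin m) →
      (∀ a → band a ≡ v → a ≢ b → x (bs , a , suc k) ≡ 0ℚ) →
      ∀ a c → _≢_ {A = E} (bs , a , c) (bs , b , suc k) →
      - (δ (band a) v * δ (toℕ c) (toℕ (suc k))) ≡ 0ℚ ⊎ x (bs , a , c) ≡ 0ℚ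
    band-supported band v b k x≡0-in-band a c e≢e₀ with δ-cases (band a) v | δ-cases (toℕ c) (toℕ (suc k))
    ... | inj₁ δ≡0′  | _         = inj₁ (-[x*y]≡0 (inj₁ δ≡0′))
    ... | inj₂ _     | inj₁ δ≡0′ = inj₁ (-[x*y]≡0 {δ (band a) v} (inj₂ δ≡0′))
    ... | inj₂ band≡v | inj₂ c≡k with toℕ-injective {i = c} {j = suc k} c≡k
    ...   | refl = inj₂ (x≡0-in-band a band≡v (e≢e₀ ∘ cong (λ a → bs , a , suc k)))

    x-bs-colBand≡0 : ∀ (a b : Fin n) (k : Fin m) → toℕ b / h ≡ 0 → toℕ a % h ≡ toℕ b % h → toℕ b % h ≢ 0 → a ≢ b →
      x (bs , a , suc k) ≡ 0ℚ
    x-bs-colBand≡0 a b k q≡0 a%h≡r r≢0 a≢b with toℕ a / h ℕ.≟ 0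
    ... | no  a/h≢0 = x-bs-special≡0 a k a/h≢0 (subst (_≢ 0) (sym a%h≡r) r≢0)
    ... | yes a/h≡0 = ⊥-elim (a≢b (toℕ-injective (/-%-injective h (trans a/h≡0 (sym q≡0)) a%h≡r)))

    colBand-supported : ∀ (b : Fin n) (k : Fin m) → toℕ b / h ≡ 0 → toℕ b % h ≢ 0 → ∀ e → e ≢ (bs , b , suc k) →
      colBandRelation (toℕ b % h) (suc k) e ≡ 0ℚ ⊎ x e ≡ 0ℚ
    colBand-supported b k q≡0 r≢0 (rc , _ , _) _    = inj₁ refl
    colBand-supported b k q≡0 r≢0 (rs , _ , _) _    = inj₁ refl
    colBand-supported b k q≡0 r≢0 (cs , a , c) _    = inj₂ (x-cs≡0 a c)
    colBand-supported b k q≡0 r≢0 (bs , a , c) e≢e₀ =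
      band-supported (λ a → toℕ a % h) (toℕ b % h) b k
        (λ a a%h≡r a≢b → x-bs-colBand≡0 a b k q≡0 a%h≡r r≢0 a≢b) a c e≢e₀

    x-bs-%≢0≡0 : ∀ (b : Fin n) (k : Fin m) → toℕ b % h ≢ 0 → x (bs , b , suc k) ≡ 0ℚ
    x-bs-%≢0≡0 b k r≢0 = byQuotient (toℕ b / h ℕ.≟ 0)
      where
      byQuotient : Dec (toℕ b / h ≡ 0) → x (bs , b , suc k) ≡ 0ℚ
      byQuotient (no  q≢0) = x-bs-special≡0 b k q≢0 r≢0
      byQuotient (yes q≡0) = isolate (colBandRelation (toℕ b % h) (suc k)) (bs , b , suc k)
                               (colBandRelation-null (toℕ b % h) (suc k)) (-δ*δ≢0 (toℕ b % h) (toℕ (suc k)))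
                               (colBand-supported b k q≡0 r≢0)

    x-bs-rowBand≡0 : ∀ (a b : Fin n) (k : Fin m) → toℕ b % h ≡ 0 → toℕ a / h ≡ toℕ b / h → a ≢ b →
      x (bs , a , suc k) ≡ 0ℚ
    x-bs-rowBand≡0 a b k r≡0 a/h≡q a≢b = byRemainder (toℕ a % h ℕ.≟ 0)
      where
      byRemainder : Dec (toℕ a % h ≡ 0) → x (bs , a , suc k) ≡ 0ℚ
      byRemainder (no  a%h≢0) = x-bs-%≢0≡0 a k a%h≢0
      byRemainder (yes a%h≡0) = ⊥-elim (a≢b (toℕ-injective (/-%-injective h a/h≡q (trans a%h≡0 (sym r≡0)))))

    rowBand-supported : ∀ (b : Fin n) (k : Fin m) → toℕ b % h ≡ 0 → ∀ e → e ≢ (bs , b , suc k) →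
      rowBandRelation (toℕ b / h) (suc k) e ≡ 0ℚ ⊎ x e ≡ 0ℚ
    rowBand-supported b k r≡0 (rc , _ , _) _    = inj₁ refl
    rowBand-supported b k r≡0 (rs , a , c) _    = inj₂ (x-rs≡0 a c)
    rowBand-supported b k r≡0 (cs , _ , _) _    = inj₁ refl
    rowBand-supported b k r≡0 (bs , a , c) e≢e₀ =
      band-supported (λ a → toℕ a / h) (toℕ b / h) b k
        (λ a a/h≡q a≢b → x-bs-rowBand≡0 a b k r≡0 a/h≡q a≢b) a c e≢e₀

    x-bs-suc≡0 : ∀ (b : Fin n) (k : Fin m) → x (bs , b , suc k) ≡ 0ℚ
    x-bs-suc≡0 b k = byRemainder (toℕ b % h ℕ.≟ 0)
      where
      byRemainder : Dec (toℕ b % h ≡ 0) → x (bs , b , suc k) ≡ 0ℚ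
      byRemainder (no  r≢0) = x-bs-%≢0≡0 b k r≢0
      byRemainder (yes r≡0) = isolate (rowBandRelation (toℕ b / h) (suc k)) (bs , b , suc k)
                                (rowBandRelation-null (toℕ b / h) (suc k)) (-δ*δ≢0 (toℕ b / h) (toℕ (suc k)))
                                (rowBand-supported b k r≡0)

    x-bs≡0 : ∀ (b k : Fin n) → x (bs , b , k) ≡ 0ℚ
    x-bs≡0 b (suc k) = x-bs-suc≡0 b k
    x-bs≡0 b zero    = isolate (boxRelation b) (bs , b , zero) (boxRelation-null b) (-δ≢0 (toℕ b)) supported
      where
      supported : ∀ e → e ≢ (bs , b , zero) → boxRelation b e ≡ 0ℚ ⊎ x e ≡ 0ℚ
      supported (rc , i , j)     _    = inj₂ (x≡0 (block₁ i j))
      supported (rs , _ , _)     _    = inj₁ refl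
      supported (cs , _ , _)     _    = inj₁ refl
      supported (bs , a , suc k) _    = inj₂ (x-bs-suc≡0 a k)
      supported (bs , a , zero)  e≢e₀ = inj₁ (-δ≡0 (e≢e₀ ∘ cong (λ a → bs , a , zero) ∘ toℕ-injective))

    vanishing : ∀ e → x e ≡ 0ℚ
    vanishing (rc , i , j) = x≡0 (block₁ i j)
    vanishing (rs , i , k) = x-rs≡0 i k
    vanishing (cs , j , k) = x-cs≡0 j k
    vanishing (bs , b , k) = x-bs≡0 b k

  rank : ℕ
  rank = n ℕ.* n ℕ.+ (n ℕ.* m ℕ.+ (m ℕ.* m ℕ.+ m ℕ.* (suc w' ℕ.* suc h')))

  Fin-rank↔Index : Fin rank ↔ Index
  Fin-rank↔Index =
    ↔-trans +↔⊎ (*↔× ⊎-↔ ↔-trans +↔⊎ (*↔× ⊎-↔ ↔-trans +↔⊎ (*↔× ⊎-↔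
    ↔-trans *↔× (↔-refl ×-↔ *↔×))))

  index : Fin rank → Index
  index = Inverse.to Fin-rank↔Index

  index-injective : ∀ {ρ ρ'} → index ρ ≡ index ρ' → ρ ≡ ρ'
  index-injective = Injection.injective (↔⇒↣ Fin-rank↔Index)

  basisEdge : Fin rank → E
  basisEdge = basisEdgeAt ∘ index

  spanDeterminedBy-basisEdge : ∀ {C : Set} (A : E → C → ℚ) → (∀ c → ⊥LeftNull (λ e → A e c)) →
    SpanDeterminedBy A basisEdge
  spanDeterminedBy-basisEdge A columns⊥ {k} a g comb≡0 = Vanishing.vanishing x x⊥ x≡0
    where
    x : E → ℚ
    x e = sumFin k (λ i → a i * A e (g i))
    x⊥ : ⊥LeftNull x
    x⊥ = ⊥LeftNull-sumFin k a (λ i e → A e (g i)) (columns⊥ ∘ g)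
    x≡0 : ∀ z → x (basisEdgeAt z) ≡ 0ℚ
    x≡0 z = subst (λ z → x (basisEdgeAt z) ≡ 0ℚ) (Inverse.strictlyInverseˡ Fin-rank↔Index z)
                  (comb≡0 (Inverse.from Fin-rank↔Index z))

  basisTileAt : Index → T
  basisTileAt (block₁ j k)   = zero , j , k
  basisTileAt (block₂ k i)   = suc i , zero , k
  basisTileAt (block₃ i j)   = suc i , suc j , zero
  basisTileAt (block₄ k β σ) = specialRow β , specialCol σ , suc k

  basisTile : Fin rank → T
  basisTile = basisTileAt ∘ index

  isZero : Fin n → ℕ
  isZero zero    = 1
  isZero (suc _) = 0

  zeros : T → ℕ
  zeros (i , j , k) = isZero i ℕ.+ (isZero j ℕ.+ isZero k)

  -- specialRow and specialCol reduce to successors, so tiles of block₄ have no zero coordinate.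
  pivotKind : T → EdgeKind
  pivotKind (_     , _     , zero)  = rc
  pivotKind (_     , zero  , suc _) = rs
  pivotKind (zero  , suc _ , suc _) = cs
  pivotKind (suc _ , suc _ , suc _) = bs

  pivotEdge : T → E
  pivotEdge t = pivotKind t , ends (pivotKind t) t

  pivot-zeros : ∀ t t' → zeros t ≢ 0 → ends (pivotKind t) t ≡ ends (pivotKind t) t' →
    t' ≡ t ⊎ zeros t' ℕ.< zeros t
  pivot-zeros (i , j , zero) (.i , .j , zero)  _ refl = inj₁ refl
  pivot-zeros (i , j , zero) (.i , .j , suc _) _ refl = inj₂ (+-monoʳ-< (isZero i) (+-monoʳ-< (isZero j) (s≤s z≤n)))
  pivot-zeros (i , zero , suc k) (.i , zero  , .(suc k)) _ refl = inj₁ refl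
  pivot-zeros (i , zero , suc k) (.i , suc _ , .(suc k)) _ refl = inj₂ (+-monoʳ-< (isZero i) (s≤s z≤n))
  pivot-zeros (zero , suc j , suc k) (zero  , .(suc j) , .(suc k)) _ refl = inj₁ refl
  pivot-zeros (zero , suc j , suc k) (suc _ , .(suc j) , .(suc k)) _ refl = inj₂ (s≤s z≤n)
  pivot-zeros (suc _ , suc _ , suc _) _ zeros≢0 _ = ⊥-elim (zeros≢0 refl)

  basisTileAt-injective : ∀ z' z → basisTileAt z' ≡ basisTileAt z → z' ≡ z
  basisTileAt-injective (block₁ _ _) (block₁ _ _) refl = refl
  basisTileAt-injective (block₂ _ _) (block₂ _ _) refl = refl
  basisTileAt-injective (block₃ _ _) (block₃ _ _) refl = refl
  basisTileAt-injective (block₄ k' β' σ') (block₄ k β σ) eq =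
    cong (inj₂ ∘ inj₂ ∘ inj₂) (cong₂ _,_ (suc-injective (cong (proj₂ ∘ proj₂) eq))
                                          (cong₂ _,_ (proj₁ same-box) (proj₂ same-box)))
    where
    same-box : β' ≡ β × σ' ≡ σ
    same-box = specialBox-injective (cong (λ t → box (proj₁ t) (proj₁ (proj₂ t))) eq)
  basisTileAt-injective (block₁ _ _)   (block₂ _ _)   ()
  basisTileAt-injective (block₁ _ _)   (block₃ _ _)   ()
  basisTileAt-injective (block₁ _ _)   (block₄ _ _ _) ()
  basisTileAt-injective (block₂ _ _)   (block₁ _ _)   ()
  basisTileAt-injective (block₂ _ _)   (block₃ _ _)   ()
  basisTileAt-injective (block₂ _ _)   (block₄ _ _ _) ()
  basisTileAt-injective (block₃ _ _)   (block₁ _ _)   ()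
  basisTileAt-injective (block₃ _ _)   (block₂ _ _)   ()
  basisTileAt-injective (block₃ _ _)   (block₄ _ _ _) ()
  basisTileAt-injective (block₄ _ _ _) (block₁ _ _)   ()
  basisTileAt-injective (block₄ _ _ _) (block₂ _ _)   ()
  basisTileAt-injective (block₄ _ _ _) (block₃ _ _)   ()

  specialPivot-unique : ∀ k β σ z' → ends bs (basisTileAt (block₄ k β σ)) ≡ ends bs (basisTileAt z') →
    z' ≡ block₄ k β σ
  specialPivot-unique k β σ (block₁ j' k')    eq = ⊥-elim (specialBox≢box-row₀ β σ j' (cong proj₁ eq))
  specialPivot-unique k β σ (block₂ k' i')    eq = ⊥-elim (specialBox≢box-col₀ β σ (suc i') (cong proj₁ eq))
  specialPivot-unique k β σ (block₃ i' j')    eq = ⊥-elim (0≢1+n (sym (cong proj₂ eq)))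
  specialPivot-unique k β σ (block₄ k' β' σ') eq =
    cong (inj₂ ∘ inj₂ ∘ inj₂) (cong₂ _,_ (suc-injective (sym (cong proj₂ eq)))
                                          (cong₂ _,_ (sym (proj₁ same-box)) (sym (proj₂ same-box))))
    where
    same-box : β ≡ β' × σ ≡ σ'
    same-box = specialBox-injective (cong proj₁ eq)

  shared-pivot : ∀ z z' →
    ends (pivotKind (basisTileAt z)) (basisTileAt z) ≡ ends (pivotKind (basisTileAt z)) (basisTileAt z') →
    z' ≡ z ⊎ zeros (basisTileAt z') ℕ.< zeros (basisTileAt z)
  shared-pivot (block₄ k β σ) z' shared = inj₁ (specialPivot-unique k β σ z' shared)
  shared-pivot z@(block₁ _ _) z' shared =
    Sum.map₁ (basisTileAt-injective z' z) (pivot-zeros (basisTileAt z) (basisTileAt z') (λ ()) shared)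
  shared-pivot z@(block₂ _ _) z' shared =
    Sum.map₁ (basisTileAt-injective z' z) (pivot-zeros (basisTileAt z) (basisTileAt z') (λ ()) shared)
  shared-pivot z@(block₃ _ _) z' shared =
    Sum.map₁ (basisTileAt-injective z' z) (pivot-zeros (basisTileAt z) (basisTileAt z') (λ ()) shared)

  tile-triangular : ∀ z z' → z' ≡ z ⊎ W h w (pivotEdge (basisTileAt z)) (basisTileAt z') ≡ 0ℚ
                                  ⊎ zeros (basisTileAt z') ℕ.< zeros (basisTileAt z)
  tile-triangular z z' =
    [ inj₂ ∘ inj₁ , Sum.map₂ inj₂ ∘ shared-pivot z z' ]′
      (W-support κ (proj₁ (ends κ t)) (proj₂ (ends κ t)) (basisTileAt z'))
    where
    t : T
    t = basisTileAt z
    κ : EdgeKind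
    κ = pivotKind t

  W-linIndep : LinIndepCols (W h w) rank basisTile
  W-linIndep = linIndep-triangular (W h w) basisTile (pivotEdge ∘ basisTile) (zeros ∘ basisTile)
    (λ ρ → W-ends (pivotKind (basisTile ρ)) (basisTile ρ))
    (λ ρ ρ' → Sum.map₁ index-injective (tile-triangular (index ρ) (index ρ')))

  pivotTileAt : Index → T
  pivotTileAt (block₁ i j)   = i , j , zero
  pivotTileAt (block₂ i k)   = i , zero , suc k
  pivotTileAt (block₃ j k)   = zero , suc j , suc k
  pivotTileAt (block₄ k β σ) = specialRow β , specialCol σ , suc k

  blockLevel : Index → ℕ
  blockLevel (block₁ _ _)   = 0
  blockLevel (block₂ _ _)   = 1
  blockLevel (block₃ _ _)   = 2
  blockLevel (block₄ _ _ _) = 3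

  W-basisEdge-pivot : ∀ z → W h w (basisEdgeAt z) (pivotTileAt z) ≡ 1ℚ
  W-basisEdge-pivot z@(block₁ _ _)   = W-ends rc (pivotTileAt z)
  W-basisEdge-pivot z@(block₂ _ _)   = W-ends rs (pivotTileAt z)
  W-basisEdge-pivot z@(block₃ _ _)   = W-ends cs (pivotTileAt z)
  W-basisEdge-pivot z@(block₄ _ _ _) = W-ends bs (pivotTileAt z)

  edge-meets-pivot : ∀ z z' → let (κ , a , b) = basisEdgeAt z' in (a , b) ≡ ends κ (pivotTileAt z) →
    z' ≡ z ⊎ blockLevel z' ℕ.< blockLevel z
  edge-meets-pivot (block₁ _ _)   (block₁ _ _)   refl = inj₁ refl
  edge-meets-pivot (block₂ _ _)   (block₁ _ _)   _    = inj₂ (s≤s z≤n)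
  edge-meets-pivot (block₃ _ _)   (block₁ _ _)   _    = inj₂ (s≤s z≤n)
  edge-meets-pivot (block₄ _ _ _) (block₁ _ _)   _    = inj₂ (s≤s z≤n)
  edge-meets-pivot (block₁ _ _)   (block₂ _ _)   ()
  edge-meets-pivot (block₂ _ _)   (block₂ _ _)   refl = inj₁ refl
  edge-meets-pivot (block₃ _ _)   (block₂ _ _)   _    = inj₂ (s≤s (s≤s z≤n))
  edge-meets-pivot (block₄ _ _ _) (block₂ _ _)   _    = inj₂ (s≤s (s≤s z≤n))
  edge-meets-pivot (block₁ _ _)   (block₃ _ _)   ()
  edge-meets-pivot (block₂ _ _)   (block₃ _ _)   ()
  edge-meets-pivot (block₃ _ _)   (block₃ _ _)   refl = inj₁ refl
  edge-meets-pivot (block₄ _ _ _) (block₃ _ _)   _    = inj₂ (s≤s (s≤s (s≤s z≤n)))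
  edge-meets-pivot (block₁ _ _)   (block₄ _ _ _) eq   = ⊥-elim (0≢1+n (sym (cong proj₂ eq)))
  edge-meets-pivot (block₂ i _)   (block₄ _ β σ) eq   = ⊥-elim (specialBox≢box-col₀ β σ i (cong proj₁ eq))
  edge-meets-pivot (block₃ j _)   (block₄ _ β σ) eq   = ⊥-elim (specialBox≢box-row₀ β σ (suc j) (cong proj₁ eq))
  edge-meets-pivot (block₄ k β σ) (block₄ k' β' σ') eq =
    inj₁ (cong (inj₂ ∘ inj₂ ∘ inj₂) (cong₂ _,_ (suc-injective (cong proj₂ eq))
                                               (cong₂ _,_ (proj₁ same-box) (proj₂ same-box))))
    where
    same-box : β' ≡ β × σ' ≡ σ
    same-box = specialBox-injective (cong proj₁ eq)

  edge-triangular : ∀ z z' →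
    z' ≡ z ⊎ W h w (basisEdgeAt z') (pivotTileAt z) ≡ 0ℚ ⊎ blockLevel z' ℕ.< blockLevel z
  edge-triangular z z' =
    [ inj₂ ∘ inj₁ , Sum.map₂ inj₂ ∘ edge-meets-pivot z z' ]′ (W-support κ a b (pivotTileAt z))
    where
    κ : EdgeKind
    κ = proj₁ (basisEdgeAt z')
    a b : Fin n
    a = proj₁ (proj₂ (basisEdgeAt z'))
    b = proj₂ (proj₂ (basisEdgeAt z'))

  rows-linIndep : LinIndepCols (λ t e → W h w e t) rank basisEdge
  rows-linIndep = linIndep-triangular (λ t e → W h w e t) basisEdge (pivotTileAt ∘ index) (blockLevel ∘ index)
    (W-basisEdge-pivot ∘ index)
    (λ ρ ρ' → Sum.map₁ index-injective (edge-triangular (index ρ) (index ρ')))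

  W-hasRank : HasRank (W h w) rank
  W-hasRank = (basisTile , W-linIndep) , ¬linIndepCols-suc (W h w) basisEdge (spanDeterminedBy-basisEdge (W h w) ⊥LeftNull-W)

  M-hasRank : HasRank (M h w) rank
  M-hasRank = (basisEdge , gram-linIndep (W h w) basisEdge rows-linIndep) ,
              ¬linIndepCols-suc (M h w) basisEdge (spanDeterminedBy-basisEdge (M h w) ⊥LeftNull-M)

open import Data.Nat using (suc; _≤_; _*_; _+_; _∸_; _^_; s≤s; z≤n)
open import Data.Product using (_×_; _,_)
open import Relation.Binary.PropositionalEquality using (_≡_; subst; sym)

proposition2p3 : (h w : ℕ) → 2 ≤ h → 2 ≤ w →
    HasRank (M h w) ((h * w) ^ 3 ∸ (h * w ∸ 1) ^ 3 + (h * w ∸ 1) * (h ∸ 1) * (w ∸ 1)) ×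
    HasRank (W h w) ((h * w) ^ 3 ∸ (h * w ∸ 1) ^ 3 + (h * w ∸ 1) * (h ∸ 1) * (w ∸ 1))
proposition2p3 (suc (suc h')) (suc (suc w')) (s≤s (s≤s z≤n)) (s≤s (s≤s z≤n)) =
  subst (HasRank (M h w)) (sym rank≡) M-hasRank , subst (HasRank (W h w)) (sym rank≡) W-hasRank
  where
  open Tiling h' w'
  rank≡ : (h * w) ^ 3 ∸ (h * w ∸ 1) ^ 3 + (h * w ∸ 1) * (h ∸ 1) * (w ∸ 1) ≡ rank
  rank≡ = NatArithmetic.rank-count m (suc h') (suc w')
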